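{- Let $s\geq 4$ be an even integer. For all integers $n,k\geq 1$, \[ D_{s}(n,k)=D_{s}(n-s/2,k-1)+\sum_{\alpha \in \mathbb{A}(s)}D_{s} \Big( n-\frac{s(k-\ell(\alpha))}{2}-| \alpha |,\;k-\ell(\alpha) \Big). \]
   Context: A partition is $s$-duplicate if every part occurring with multiplicity greater than one is divisible by $s/2$. $D_s(n,k)$ is the number of $s$-duplicate partitions of $n$ into exactly $k$ parts. $\mathbb{A}(s)$ is the set consisting of the empty partition together with all partitions into distinct parts each at most $s/2-1$ (so $|\mathbb{A}(s)|=2^{s/2-1}$); for $\alpha\in\mathbb{A}(s)$, $|\alpha|$ is the sum of its parts and $\ell(\alpha)$ its number of parts, with $|\emptyset|=\ell(\emptyset)=0$. Conventions: $D_s(0,0)=1$, $D_s(m,0)=0$ for $m\neq 0$, and $D_s(m,j)=0$ whenever $m<0$ or $j<0$. -}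

module Defs where

open import Data.Nat using (ℕ; zero; suc; _+_; _*_; _≤_; _/_; _≟_; _≤?_; _≥_)

open import Data.Nat.Divisibility using (_∣_; _∣?_)
open import Data.Integer as ℤ using (ℤ; +_; -[1+_])
open import Data.List using (List; []; _∷_; length; filter; map; concatMap; upTo; _++_)
open import Data.Nat.ListAction using (sum)
open import Data.List.Relation.Unary.All using (All; all?)
open import Data.List.Relation.Unary.Linked using (Linked; linked?)
open import Data.Product using (_×_)
open import Relation.Binary.PropositionalEquality using (_≡_)
open import Relation.Nullary using (Dec)
open import Relation.Nullary.Decidable using (_×-dec_; _→-dec_)

mult : ℕ → List ℕ → ℕ
mult x p = length (filter (_≟ x) p)

IsPartition : ℕ → ℕ → List ℕ → Set
IsPartition n k p = Linked _≥_ p × All (1 ≤_) p × sum p ≡ n × length p ≡ k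

IsSDuplicate : ℕ → List ℕ → Set
IsSDuplicate s p = All (λ x → 2 ≤ mult x p → (s / 2) ∣ x) p

isPartition? : ∀ n k p → Dec (IsPartition n k p)
isPartition? n k p =
  linked? (λ x y → y ≤? x) p ×-dec (all? (1 ≤?_) p ×-dec ((sum p ≟ n) ×-dec (length p ≟ k)))

isSDuplicate? : ∀ s p → Dec (IsSDuplicate s p)
isSDuplicate? s p = all? (λ x → (2 ≤? mult x p) →-dec ((s / 2) ∣? x)) p

listsOf : ℕ → ℕ → List (List ℕ)
listsOf zero    m = [] ∷ []
listsOf (suc k) m = concatMap (λ x → map (x ∷_) (listsOf k m)) (upTo (suc m))

-- every partition of n into k parts is among listsOf k n (each part is ≤ n);
-- D s n k = number of s-duplicate partitions of n into exactly k parts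
D : ℕ → ℕ → ℕ → ℕ
D s n k = length (filter (λ p → isPartition? n k p ×-dec isSDuplicate? s p) (listsOf k n))

Dℤ : ℕ → ℤ → ℤ → ℕ
Dℤ s (+ m)    (+ j)    = D s m j
Dℤ s (+ m)    -[1+ _ ] = 0
Dℤ s -[1+ _ ] _        = 0

sublists : List ℕ → List (List ℕ)
sublists []       = [] ∷ []
sublists (x ∷ xs) = sublists xs ++ map (x ∷_) (sublists xs)

-- 𝔸(s): the empty partition and all partitions into distinct parts each ≤ s/2 - 1,
-- i.e. all subsets of {1,…,s/2-1} (listed in increasing order)
𝔸 : ℕ → List (List ℕ)
𝔸 s = sublists (map suc (upTo (s / 2 Data.Nat.∸ 1)))

-- View a partition as a sorted multiset of parts. The s-duplicate partitions of n into k parts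
-- containing the part s/2 correspond, by deleting one copy of s/2, to those of n - s/2 into
-- k - 1 parts (repeating s/2 is always allowed). In the remaining ones a part below s/2 is not
-- divisible by s/2, so it occurs at most once: these small parts form a set α ∈ 𝔸(s). The other
-- k - ℓ(α) parts all exceed s/2, and subtracting s/2 from each (which preserves divisibility by
-- s/2) leaves an s-duplicate partition of n - s(k - ℓ(α))/2 - |α| into k - ℓ(α) parts. The sum
-- over α is assembled one small part x at a time, splitting on whether x occurs.

module Submission where

open import Level using (0ℓ)
open import Data.Nat using (ℕ; zero; suc; _+_; _∸_; _≤_; _<_; _≥_; _/_; _≟_; _<?_; z≤n; s≤s; s≤s⁻¹; >-nonZero)
import Data.Nat as ℕ
open import Data.Nat.Properties
open import Data.Nat.Divisibility using (_∣_; ∣-refl; ∣⇒≤; ∣m∣n⇒∣m+n; ∣m+n∣m⇒∣n)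
open import Data.Nat.DivMod using (/-monoˡ-≤)
open import Data.Nat.ListAction using (sum)
open import Data.Nat.ListAction.Properties using (sum-↭; sum-++)
open import Data.Integer as ℤ using (ℤ; +_; -[1+_]; _-_; _*_)
import Data.Integer.Properties as ℤ
open import Data.Integer.Tactic.RingSolver using (solve-∀)
open import Data.Nat.Tactic.RingSolver using () renaming (solve-∀ to ℕ-solve-∀)
open import Data.List using (List; []; _∷_; _++_; length; map; filter; upTo; concatMap; cartesianProductWith)
open import Data.List.Properties using (length-map; map-injective; map-++; map-∘; map-cong; filter-accept; filter-reject; filter-some)
open import Data.List.Membership.Propositional using (_∈_; _∉_)
open import Data.List.Membership.DecPropositional _≟_ using (_∈?_)
open import Data.List.Membership.Propositional.Properties
  using (∈-filter⁺; ∈-filter⁻; ∈-map⁺; ∈-map⁻; ∈-upTo⁺; ∈-upTo⁻; ∈-∃++; ∈-cartesianProductWith⁺; ∈-cartesianProductWith⁻)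
open import Data.List.Relation.Unary.Any as Any using (here; there)
open import Data.List.Relation.Unary.All as All using (All; []; _∷_; all?)
open import Data.List.Relation.Unary.All.Properties using (¬Any⇒All¬; All¬⇒¬Any) renaming (map⁺ to All-map⁺; map⁻ to All-map⁻)
open import Data.List.Relation.Unary.Linked as Linked using (Linked)
open import Data.List.Relation.Unary.Linked.Properties using () renaming (map⁺ to Linked-map⁺; map⁻ to Linked-map⁻)
open import Data.List.Relation.Unary.Unique.Propositional using (Unique; []; _∷_)
import Data.List.Relation.Unary.Unique.Propositional.Properties as Unique
open import Data.List.Membership.Propositional.Properties.WithK using (unique∧set⇒bag)
open import Data.List.Relation.Binary.BagAndSetEquality using (∼bag⇒↭)
open import Data.List.Relation.Binary.Permutation.Propositional using (_↭_; ↭-sym; ↭-trans; ↭-reflexive; ↭⇒↭ₛ)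
open import Data.List.Relation.Binary.Permutation.Propositional.Properties
  using (↭-length; All-resp-↭; ∈-resp-↭; filter-↭; shift; drop-∷)
open import Data.List.Relation.Binary.Equality.Propositional using (≋⇒≡)
open import Data.List.Relation.Unary.Sorted.TotalOrder.Properties using (↗↭↗⇒≋)
open import Relation.Binary.Bundles using (DecTotalOrder)
open import Relation.Binary.Properties.DecTotalOrder ≤-decTotalOrder using (≥-decTotalOrder)
open import Data.List.Sort.InsertionSort.Base ≥-decTotalOrder using (insert; sort)
open import Data.List.Sort.InsertionSort.Properties ≥-decTotalOrder using (insert-↭; insert-cong-↭; insert-↗; sort-↭; sort-↗)
open import Data.Product using (∃-syntax; _×_; _,_; proj₁; proj₂)
open import Data.Sum using (_⊎_; inj₁; inj₂; [_,_]′; map₁)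
open import Data.Empty using (⊥-elim)
open import Function using (_∘_; id)
open import Function.Bundles using (_⇔_; mk⇔; Equivalence)
import Function.Properties.Equivalence as ⇔
open import Data.Product.Function.NonDependent.Propositional using (_×-⇔_)
open import Relation.Nullary using (¬_; yes; no)
open import Relation.Nullary.Decidable using (_×-dec_; _⊎-dec_)
open import Relation.Unary using (Pred; Decidable; _∩_; _≐_; ∁)
open import Relation.Unary.Properties using (∁?; ≐-refl)
open import Relation.Binary.Definitions using (_Respects_)
open import Relation.Binary.PropositionalEquality using (_≡_; _≢_; refl; sym; trans; cong; cong₂; subst; module ≡-Reasoning)

open import Defs

open Equivalence using (to; from)

record Enumerates {A : Set} (P : Pred A 0ℓ) (xs : List A) : Set where
  field
    unique   : Unique xs
    sound    : ∀ {x} → x ∈ xs → P x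
    complete : ∀ {x} → P x → x ∈ xs
open Enumerates

module _ {A : Set} {P : Pred A 0ℓ} where

  []-enumerates : (∀ {x} → ¬ P x) → Enumerates P []
  []-enumerates ¬P = record { unique = [] ; sound = λ () ; complete = ⊥-elim ∘ ¬P }

  enumerates-≐ : ∀ {Q : Pred A 0ℓ} {xs} → P ≐ Q → Enumerates P xs → Enumerates Q xs
  enumerates-≐ (P⊆Q , Q⊆P) e =
    record { unique = unique e ; sound = P⊆Q ∘ sound e ; complete = complete e ∘ Q⊆P }

  filter-enumerates : ∀ {Q : Pred A 0ℓ} {xs} (Q? : Decidable Q) →
                      Enumerates P xs → Enumerates (P ∩ Q) (filter Q? xs)
  filter-enumerates Q? e = record
    { unique   = Unique.filter⁺ Q? (unique e)
    ; sound    = λ x∈ → let x∈xs , q = ∈-filter⁻ Q? x∈ in sound e x∈xs , q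
    ; complete = λ (p , q) → ∈-filter⁺ Q? (complete e p) q
    }

  length-≐ : ∀ {Q : Pred A 0ℓ} {xs ys} → P ≐ Q → Enumerates P xs → Enumerates Q ys → length xs ≡ length ys
  length-≐ (P⊆Q , Q⊆P) e e′ = ↭-length (∼bag⇒↭ (unique∧set⇒bag (unique e) (unique e′)
    (mk⇔ (complete e′ ∘ P⊆Q ∘ sound e) (complete e ∘ Q⊆P ∘ sound e′))))

length-filter-∁ : ∀ {A : Set} {P : Pred A 0ℓ} (P? : Decidable P) xs →
                  length (filter P? xs) + length (filter (∁? P?) xs) ≡ length xs
length-filter-∁ P? [] = refl
length-filter-∁ P? (x ∷ xs) with P? x
... | yes _ = cong suc (length-filter-∁ P? xs)
... | no  _ = trans (+-suc _ _) (cong suc (length-filter-∁ P? xs))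

module _ {A B : Set} {f : A → B} where

  unique-map : ∀ {xs} → (∀ {x y} → x ∈ xs → y ∈ xs → f x ≡ f y → x ≡ y) →
               Unique xs → Unique (map f xs)
  unique-map {[]}     inj []         = []
  unique-map {x ∷ xs} inj (x∉ ∷ u) =
    All-map⁺ (All.tabulate λ y∈ fx≡fy → All.lookup x∉ y∈ (inj (here refl) (there y∈) fx≡fy))
    ∷ unique-map (λ x∈ y∈ → inj (there x∈) (there y∈)) u

  length-≡-bijection : ∀ {P : Pred A 0ℓ} {Q : Pred B 0ℓ} {xs ys} →
    (∀ {x} → P x → Q (f x)) → (∀ {x y} → P x → P y → f x ≡ f y → x ≡ y) →
    (∀ {y} → Q y → ∃[ x ] P x × f x ≡ y) →
    Enumerates P xs → Enumerates Q ys → length xs ≡ length ys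
  length-≡-bijection {Q = Q} {xs} P⇒Q inj surj e e′ = trans (sym (length-map f xs)) (length-≐ ≐-refl image e′)
    where
    image : Enumerates Q (map f xs)
    image = record
      { unique   = unique-map (λ x∈ y∈ → inj (sound e x∈) (sound e y∈)) (unique e)
      ; sound    = λ y∈ → let x , x∈ , y≡fx = ∈-map⁻ f y∈ in subst Q (sym y≡fx) (P⇒Q (sound e x∈))
      ; complete = λ q → let x , p , fx≡y = surj q in subst (_∈ map f xs) fx≡y (∈-map⁺ f (complete e p))
      }

concatMap-map≡cartesianProductWith : ∀ {A B C : Set} (f : A → B → C) xs ys →
  concatMap (λ x → map (f x) ys) xs ≡ cartesianProductWith f xs ys
concatMap-map≡cartesianProductWith f []       ys = refl
concatMap-map≡cartesianProductWith f (x ∷ xs) ys = cong (map (f x) ys ++_) (concatMap-map≡cartesianProductWith f xs ys)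

listsOf-enumerates : ∀ k m → Enumerates (λ p → length p ≡ k × All (_≤ m) p) (listsOf k m)
listsOf-enumerates zero    m = record
  { unique   = [] ∷ []
  ; sound    = λ { (here refl) → refl , [] }
  ; complete = λ { {[]} _ → here refl }
  }
listsOf-enumerates (suc k) m =
  subst (Enumerates _) (sym (concatMap-map≡cartesianProductWith _∷_ (upTo (suc m)) (listsOf k m))) record
  { unique   = Unique.cartesianProductWith⁺ _∷_ (λ { refl → refl , refl }) (Unique.upTo⁺ (suc m)) (unique e)
  ; sound    = λ p∈ → let x , q , x∈ , q∈ , p≡x∷q =
                            ∈-cartesianProductWith⁻ _∷_ (upTo (suc m)) (listsOf k m) p∈
                          |q|≡k , q≤m = sound e q∈
                      in subst (λ p → length p ≡ suc k × All (_≤ m) p) (sym p≡x∷q)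
                           (cong suc |q|≡k , s≤s⁻¹ (∈-upTo⁻ x∈) ∷ q≤m)
  ; complete = λ { {x ∷ q} (|p|≡1+k , x≤m ∷ q≤m) →
                 ∈-cartesianProductWith⁺ _∷_ (∈-upTo⁺ (s≤s x≤m))
                   (complete e (suc-injective |p|≡1+k , q≤m)) }
  }
  where e = listsOf-enumerates k m

Sorted : List ℕ → Set
Sorted = Linked _≥_

sorted-↭⇒≡ : ∀ {p q} → Sorted p → Sorted q → p ↭ q → p ≡ q
sorted-↭⇒≡ p↗ q↗ p↭q =
  ≋⇒≡ (↗↭↗⇒≋ (DecTotalOrder.totalOrder ≥-decTotalOrder) p↗ q↗ (↭⇒↭ₛ p↭q))

insert-injective : ∀ x {q q′} → Sorted q → Sorted q′ → insert x q ≡ insert x q′ → q ≡ q′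
insert-injective x {q} {q′} q↗ q′↗ eq = sorted-↭⇒≡ q↗ q′↗ (drop-∷
  (↭-trans (↭-sym (insert-↭ x q)) (↭-trans (↭-reflexive eq) (insert-↭ x q′))))

∈⇒≡insert : ∀ {x p} → Sorted p → x ∈ p → ∃[ q ] Sorted q × insert x q ≡ p
∈⇒≡insert {x} p↗ x∈p with ys , zs , refl ← ∈-∃++ x∈p =
  sort (ys ++ zs) , sort-↗ (ys ++ zs) ,
  sorted-↭⇒≡ (insert-↗ x (sort-↗ (ys ++ zs))) p↗
    (↭-trans (insert-cong-↭ (sort-↭ (ys ++ zs))) (↭-sym (shift x ys zs)))

module _ {P Q : Pred (List ℕ) 0ℓ} (P-resp-↭ : P Respects _↭_)
         {x : ℕ} (P∷⇔Q : ∀ {q} → P (x ∷ q) ⇔ Q q) where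

  length-filter-∈ : ∀ {ps qs} → Enumerates (Sorted ∩ P) ps → Enumerates (Sorted ∩ Q) qs →
                    length (filter (x ∈?_) ps) ≡ length qs
  length-filter-∈ eP eQ =
    sym (length-≡-bijection into (λ (q↗ , _) (q′↗ , _) → insert-injective x q↗ q′↗) onto
           eQ (filter-enumerates (x ∈?_) eP))
    where
    into : ∀ {q} → (Sorted ∩ Q) q → ((Sorted ∩ P) ∩ (x ∈_)) (insert x q)
    into {q} (q↗ , Qq) = (insert-↗ x q↗ , P-resp-↭ (↭-sym (insert-↭ x q)) (from P∷⇔Q Qq)) ,
                         ∈-resp-↭ (↭-sym (insert-↭ x q)) (here refl)
    onto : ∀ {p} → ((Sorted ∩ P) ∩ (x ∈_)) p → ∃[ q ] (Sorted ∩ Q) q × insert x q ≡ p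
    onto ((p↗ , Pp) , x∈p) with q , q↗ , refl ← ∈⇒≡insert p↗ x∈p =
      q , (q↗ , to P∷⇔Q (P-resp-↭ (insert-↭ x q) Pp)) , refl

mult-∷-≡ : ∀ x q → mult x (x ∷ q) ≡ suc (mult x q)
mult-∷-≡ x q = cong length (filter-accept (_≟ x) refl)

mult-∷-≢ : ∀ {x y} q → x ≢ y → mult y (x ∷ q) ≡ mult y q
mult-∷-≢ {y = y} q x≢y = cong length (filter-reject (_≟ y) x≢y)

mult-∷-≥ : ∀ x y q → mult y q ≤ mult y (x ∷ q)
mult-∷-≥ x y q with x ≟ y
... | yes refl = ≤-trans (n≤1+n _) (≤-reflexive (sym (mult-∷-≡ x q)))
... | no  x≢y = ≤-reflexive (sym (mult-∷-≢ q x≢y))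

mult-↭ : ∀ y {p q} → p ↭ q → mult y p ≡ mult y q
mult-↭ y p↭q = ↭-length (filter-↭ (_≟ y) p↭q)

∈⇒1≤mult : ∀ {y p} → y ∈ p → 1 ≤ mult y p
∈⇒1≤mult y∈p = filter-some (_≟ _) (Any.map sym y∈p)

1≤mult⇒∈ : ∀ {y} p → 1 ≤ mult y p → y ∈ p
1≤mult⇒∈ {y} p 1≤m with filter (_≟ y) p in eq
1≤mult⇒∈ {y} p () | []
... | z ∷ _ with z∈p , refl ← ∈-filter⁻ (_≟ y) {xs = p} (subst (z ∈_) (sym eq) (here refl)) = z∈p

RepeatsDivisibleBy : ℕ → List ℕ → Set
RepeatsDivisibleBy d p = ∀ y → 2 ≤ mult y p → d ∣ y

isSDuplicate⇔ : ∀ {s p} → IsSDuplicate s p ⇔ RepeatsDivisibleBy (s / 2) p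
isSDuplicate⇔ {p = p} = mk⇔
  (λ dup y 2≤m → All.lookup dup (1≤mult⇒∈ p (≤-trans (s≤s z≤n) 2≤m)) 2≤m)
  (λ rep → All.tabulate λ {y} _ → rep y)

repeatsDivisibleBy-↭ : ∀ {d} → RepeatsDivisibleBy d Respects _↭_
repeatsDivisibleBy-↭ p↭q rep y 2≤m = rep y (subst (2 ≤_) (sym (mult-↭ y p↭q)) 2≤m)

repeatsDivisibleBy-∷ : ∀ {d x q} →
  RepeatsDivisibleBy d (x ∷ q) ⇔ ((x ∈ q → d ∣ x) × RepeatsDivisibleBy d q)
repeatsDivisibleBy-∷ {d} {x} {q} = mk⇔
  (λ rep → (λ x∈q → rep x (subst (2 ≤_) (sym (mult-∷-≡ x q)) (s≤s (∈⇒1≤mult x∈q)))) ,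
           (λ y 2≤m → rep y (≤-trans 2≤m (mult-∷-≥ x y q))))
  (λ (head , rep) → repeat head rep)
  where
  repeat : (x ∈ q → d ∣ x) → RepeatsDivisibleBy d q → RepeatsDivisibleBy d (x ∷ q)
  repeat head rep y 2≤m with x ≟ y
  ... | yes refl = head (1≤mult⇒∈ q (s≤s⁻¹ (subst (2 ≤_) (mult-∷-≡ x q) 2≤m)))
  ... | no x≢y   = rep y (subst (2 ≤_) (mult-∷-≢ q x≢y) 2≤m)

repeatsDivisibleBy-map : ∀ {d} q → RepeatsDivisibleBy d (map (d ℕ.+_) q) ⇔ RepeatsDivisibleBy d q
repeatsDivisibleBy-map         []      = mk⇔ (λ _ _ ()) (λ _ _ ())
repeatsDivisibleBy-map {d} (x ∷ q) =
  ⇔.trans repeatsDivisibleBy-∷ (⇔.trans (head ×-⇔ repeatsDivisibleBy-map q) (⇔.sym repeatsDivisibleBy-∷))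
  where
  head : (d + x ∈ map (d ℕ.+_) q → d ∣ d + x) ⇔ (x ∈ q → d ∣ x)
  head = mk⇔
    (λ h x∈q → ∣m+n∣m⇒∣n (h (∈-map⁺ (d ℕ.+_) x∈q)) ∣-refl)
    (λ h d+x∈ → let z , z∈q , d+x≡d+z = ∈-map⁻ (d ℕ.+_) d+x∈ in
                ∣m∣n⇒∣m+n ∣-refl (h (subst (_∈ q) (sym (+-cancelˡ-≡ d x z d+x≡d+z)) z∈q)))

+≡⇔≡- : ∀ a b c → a ℤ.+ b ≡ c ⇔ b ≡ c - a
+≡⇔≡- a b c = mk⇔ (λ { refl → b≡a+b-a a b }) (λ { refl → a+[c-a]≡c a c })
  where
  b≡a+b-a : ∀ a b → b ≡ a ℤ.+ b - a
  b≡a+b-a = solve-∀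
  a+[c-a]≡c : ∀ a c → a ℤ.+ (c - a) ≡ c
  a+[c-a]≡c = solve-∀

∈⇒≤sum : ∀ {x p} → x ∈ p → x ≤ sum p
∈⇒≤sum {p = y ∷ p} (here refl) = m≤m+n y (sum p)
∈⇒≤sum {p = y ∷ p} (there x∈p) = ≤-trans (∈⇒≤sum x∈p) (m≤n+m (sum p) y)

sum-map-+ : ∀ d q → sum (map (d ℕ.+_) q) ≡ d ℕ.* length q + sum q
sum-map-+ d []      = sym (trans (+-identityʳ _) (*-zeroʳ d))
sum-map-+ d (x ∷ q) = trans (cong ((d + x) ℕ.+_) (sum-map-+ d q)) (regroup d x (length q) (sum q))
  where
  regroup : ∀ d x l s → d + x + (d ℕ.* l + s) ≡ d ℕ.* suc l + (x + s)
  regroup = ℕ-solve-∀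

-- Sizes are integers so that negative n or k give the empty set, as in the definition of Dℤ.
PartitionBag : ℤ → ℤ → List ℕ → Set
PartitionBag n k p = All (1 ≤_) p × + sum p ≡ n × + length p ≡ k

partitionBag-↭ : ∀ {n k} → PartitionBag n k Respects _↭_
partitionBag-↭ p↭q (pos , Σ≡n , len≡k) =
  All-resp-↭ p↭q pos , trans (cong +_ (sym (sum-↭ p↭q))) Σ≡n , trans (cong +_ (sym (↭-length p↭q))) len≡k

partitionBag-∷ : ∀ {n k x q} → 1 ≤ x → PartitionBag n k (x ∷ q) ⇔ PartitionBag (n - + x) (k - + 1) q
partitionBag-∷ {n} {k} {x} {q} 1≤x = mk⇔
  (λ { (_ ∷ pos , Σ≡n , len≡k) → pos , to Σ⇔ Σ≡n , to len⇔ len≡k })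
  (λ (pos , Σ≡n , len≡k) → 1≤x ∷ pos , from Σ⇔ Σ≡n , from len⇔ len≡k)
  where
  Σ⇔   = +≡⇔≡- (+ x) (+ sum q) n
  len⇔ = +≡⇔≡- (+ 1) (+ length q) k

partitionBag-map : ∀ d {n k} q →
  (PartitionBag n k (map (d ℕ.+_) q) × All (d <_) (map (d ℕ.+_) q)) ⇔ PartitionBag (n - + d * k) k q
partitionBag-map d {n} {k} q = mk⇔
  (λ ((_ , Σ≡n , len≡k) , d<) →
     All.map (+-cancelˡ-≤ d 1 _ ∘ ≤-trans (≤-reflexive (+-comm d 1))) (All-map⁻ d<) ,
     to (+≡⇔≡- (+ d * k) (+ sum q) n) (trans (sym (Σ-shift (len≡ len≡k))) Σ≡n) ,
     len≡ len≡k)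
  (λ (pos , Σ≡ , len≡k) →
     (All-map⁺ (All.map (λ {y} 1≤y → ≤-trans 1≤y (m≤n+m y d)) pos) ,
      trans (Σ-shift len≡k) (from (+≡⇔≡- (+ d * k) (+ sum q) n) Σ≡) ,
      trans (cong +_ (length-map _ q)) len≡k) ,
     All-map⁺ (All.map (m<m+n d) pos))
  where
  len≡ : + length (map (d ℕ.+_) q) ≡ k → + length q ≡ k
  len≡ = trans (cong +_ (sym (length-map _ q)))
  Σ-shift : + length q ≡ k → + sum (map (d ℕ.+_) q) ≡ + d * k ℤ.+ + sum q
  Σ-shift refl = trans (cong +_ (sum-map-+ d q)) (cong (ℤ._+ + sum q) (ℤ.pos-* d (length q)))

∈-map-suc-upTo-pred : ∀ {y} m → y ∈ map suc (upTo (m ∸ 1)) ⇔ (1 ≤ y × y < m)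
∈-map-suc-upTo-pred zero    = mk⇔ (λ ()) (λ ())
∈-map-suc-upTo-pred (suc m) = mk⇔
  (λ y∈ → let i , i∈ , y≡1+i = ∈-map⁻ suc y∈ in
           subst (λ y → 1 ≤ y × y < suc m) (sym y≡1+i) (s≤s z≤n , s≤s (∈-upTo⁻ i∈)))
  (λ { (s≤s _ , s≤s i<m) → ∈-map⁺ suc (∈-upTo⁺ i<m) })

module Counting (s : ℕ) where

  half : ℕ
  half = s / 2

  SDupBag : ℤ → ℤ → List ℕ → Set
  SDupBag n k p = PartitionBag n k p × RepeatsDivisibleBy half p

  sDupBag-↭ : ∀ {n k} → SDupBag n k Respects _↭_
  sDupBag-↭ p↭q (bag , rep) = partitionBag-↭ p↭q bag , repeatsDivisibleBy-↭ p↭q rep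

  sDupBag-∷ : ∀ {n k x q} → 1 ≤ x →
    SDupBag n k (x ∷ q) ⇔ (SDupBag (n - + x) (k - + 1) q × (x ∈ q → half ∣ x))
  sDupBag-∷ 1≤x = mk⇔
    (λ (bag , rep) → let head , rep′ = to repeatsDivisibleBy-∷ rep in
                     (to (partitionBag-∷ 1≤x) bag , rep′) , head)
    (λ ((bag , rep) , head) → from (partitionBag-∷ 1≤x) bag , from repeatsDivisibleBy-∷ (head , rep))

  partitionsℤ : ℤ → ℤ → List (List ℕ)
  partitionsℤ (+ n)    (+ k)    = filter (λ p → isPartition? n k p ×-dec isSDuplicate? s p) (listsOf k n)
  partitionsℤ (+ n)    -[1+ _ ] = []
  partitionsℤ -[1+ _ ] _        = []

  length-partitionsℤ : ∀ n k → length (partitionsℤ n k) ≡ Dℤ s n k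
  length-partitionsℤ (+ n)    (+ k)    = refl
  length-partitionsℤ (+ n)    -[1+ _ ] = refl
  length-partitionsℤ -[1+ _ ] _        = refl

  partitionsℤ-enumerates : ∀ n k → Enumerates (Sorted ∩ SDupBag n k) (partitionsℤ n k)
  partitionsℤ-enumerates (+ n) (+ k) = enumerates-≐ (⊆ , ⊇) (filter-enumerates _ (listsOf-enumerates k n))
    where
    Listed : List ℕ → Set
    Listed p = (length p ≡ k × All (_≤ n) p) × IsPartition n k p × IsSDuplicate s p
    ⊆ : ∀ {p} → Listed p → (Sorted ∩ SDupBag (+ n) (+ k)) p
    ⊆ (_ , (p↗ , pos , Σ≡n , len≡k) , dup) =
      p↗ , (pos , cong +_ Σ≡n , cong +_ len≡k) , to (isSDuplicate⇔ {s}) dup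
    ⊇ : ∀ {p} → (Sorted ∩ SDupBag (+ n) (+ k)) p → Listed p
    ⊇ {p} (p↗ , (pos , Σ≡n , len≡k) , rep) =
      (ℤ.+-injective len≡k , subst (λ m → All (_≤ m) p) (ℤ.+-injective Σ≡n) (All.tabulate ∈⇒≤sum)) ,
      (p↗ , pos , ℤ.+-injective Σ≡n , ℤ.+-injective len≡k) , from (isSDuplicate⇔ {s}) rep
  partitionsℤ-enumerates (+ n)    -[1+ _ ] = []-enumerates λ { (_ , (_ , _ , ()) , _) }
  partitionsℤ-enumerates -[1+ _ ] _        = []-enumerates λ { (_ , (_ , () , _) , _) }

  SmallPartsIn : List ℕ → List ℕ → Set
  SmallPartsIn xs = All (λ y → y ∈ xs ⊎ half < y)

  smallPartsIn? : ∀ xs → Decidable (SmallPartsIn xs)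
  smallPartsIn? xs = all? (λ y → (y ∈? xs) ⊎-dec (half <? y))

  smallPartsIn-∷ : ∀ {x xs p} → x ∉ xs → x ≤ half →
    (x ∉ p × SmallPartsIn (x ∷ xs) p) ⇔ SmallPartsIn xs p
  smallPartsIn-∷ {x} {xs} {p} x∉xs x≤half = mk⇔
    (λ (x∉p , small) → All.zipWith drop-x (¬Any⇒All¬ p x∉p , small))
    (λ small → (λ x∈p → [ x∉xs , (λ half<x → <⇒≱ half<x x≤half) ]′ (All.lookup small x∈p)) ,
               All.map (map₁ there) small)
    where
    drop-x : ∀ {y} → x ≢ y × (y ∈ x ∷ xs ⊎ half < y) → y ∈ xs ⊎ half < y
    drop-x (x≢y , inj₁ (here y≡x)) = ⊥-elim (x≢y (sym y≡x))
    drop-x (_   , inj₁ (there y∈)) = inj₁ y∈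
    drop-x (_   , inj₂ half<y)     = inj₂ half<y

  partitionsIn : List ℕ → ℤ → ℤ → List (List ℕ)
  partitionsIn xs n k = filter (smallPartsIn? xs) (partitionsℤ n k)

  partitionsIn-enumerates : ∀ xs n k → Enumerates (Sorted ∩ (SDupBag n k ∩ SmallPartsIn xs)) (partitionsIn xs n k)
  partitionsIn-enumerates xs n k = enumerates-≐
    ((λ ((p↗ , bag) , small) → p↗ , bag , small) , (λ (p↗ , bag , small) → (p↗ , bag) , small))
    (filter-enumerates (smallPartsIn? xs) (partitionsℤ-enumerates n k))

  smallParts : List ℕ
  smallParts = map suc (upTo (half ∸ 1))

  ∉⇔smallPartsIn-smallParts : ∀ {p} → All (1 ≤_) p → half ∉ p ⇔ SmallPartsIn smallParts p
  ∉⇔smallPartsIn-smallParts {p} pos = mk⇔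
    (λ half∉p → All.zipWith classify (pos , ¬Any⇒All¬ p half∉p))
    (λ small half∈p → [ (λ half∈ → <-irrefl refl (proj₂ (to (∈-map-suc-upTo-pred half) half∈))) ,
                          <-irrefl refl ]′ (All.lookup small half∈p))
    where
    classify : ∀ {y} → 1 ≤ y × half ≢ y → y ∈ smallParts ⊎ half < y
    classify {y} (1≤y , half≢y) with y <? half
    ... | yes y<half = inj₁ (from (∈-map-suc-upTo-pred half) (1≤y , y<half))
    ... | no  y≮half = inj₂ (≤∧≢⇒< (≮⇒≥ y≮half) half≢y)

  length-partitionsℤ-split : 1 ≤ half → ∀ n k →
    length (partitionsℤ n k) ≡ length (partitionsℤ (n - + half) (k - + 1)) + length (partitionsIn smallParts n k)
  length-partitionsℤ-split 1≤half n k = begin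
      length ps
    ≡⟨ sym (length-filter-∁ (half ∈?_) ps) ⟩
      length (filter (half ∈?_) ps) + length (filter (∁? (half ∈?_)) ps)
    ≡⟨ cong₂ _+_ with-half without-half ⟩
      length (partitionsℤ (n - + half) (k - + 1)) + length (partitionsIn smallParts n k)
    ∎
    where
    open ≡-Reasoning
    ps = partitionsℤ n k
    remove-half : ∀ {q} → SDupBag n k (half ∷ q) ⇔ SDupBag (n - + half) (k - + 1) q
    remove-half = mk⇔ (proj₁ ∘ to (sDupBag-∷ 1≤half))
                      (λ bag → from (sDupBag-∷ 1≤half) (bag , λ _ → ∣-refl))
    with-half : length (filter (half ∈?_) ps) ≡ length (partitionsℤ (n - + half) (k - + 1))
    with-half = length-filter-∈ sDupBag-↭ remove-half (partitionsℤ-enumerates n k) (partitionsℤ-enumerates _ _)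
    without-half : length (filter (∁? (half ∈?_)) ps) ≡ length (partitionsIn smallParts n k)
    without-half = length-≐
      ((λ ((p↗ , bag) , half∉p) → p↗ , bag , to (∉⇔smallPartsIn-smallParts (proj₁ (proj₁ bag))) half∉p) ,
       (λ (p↗ , bag , small) → (p↗ , bag) , from (∉⇔smallPartsIn-smallParts (proj₁ (proj₁ bag))) small))
      (filter-enumerates (∁? (half ∈?_)) (partitionsℤ-enumerates n k)) (partitionsIn-enumerates smallParts n k)

  length-partitionsIn-∷ : ∀ {x xs} → 1 ≤ x → x < half → x ∉ xs → ∀ n k →
    length (partitionsIn (x ∷ xs) n k) ≡ length (partitionsIn xs n k) + length (partitionsIn xs (n - + x) (k - + 1))
  length-partitionsIn-∷ {x} {xs} 1≤x x<half x∉xs n k = begin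
      length ps
    ≡⟨ sym (length-filter-∁ (x ∈?_) ps) ⟩
      length (filter (x ∈?_) ps) + length (filter (∁? (x ∈?_)) ps)
    ≡⟨ +-comm (length (filter (x ∈?_) ps)) _ ⟩
      length (filter (∁? (x ∈?_)) ps) + length (filter (x ∈?_) ps)
    ≡⟨ cong₂ _+_ without-x with-x ⟩
      length (partitionsIn xs n k) + length (partitionsIn xs (n - + x) (k - + 1))
    ∎
    where
    open ≡-Reasoning
    ps = partitionsIn (x ∷ xs) n k
    drop-x : ∀ {p} → (x ∉ p × SmallPartsIn (x ∷ xs) p) ⇔ SmallPartsIn xs p
    drop-x = smallPartsIn-∷ x∉xs (<⇒≤ x<half)
    half∤x : ¬ half ∣ x
    half∤x half∣x = <⇒≱ x<half (∣⇒≤ ⦃ >-nonZero 1≤x ⦄ half∣x)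
    remove-x : ∀ {q} → (SDupBag n k ∩ SmallPartsIn (x ∷ xs)) (x ∷ q) ⇔
                       (SDupBag (n - + x) (k - + 1) ∩ SmallPartsIn xs) q
    remove-x = mk⇔
      (λ { (bag , _ ∷ small) → let bag′ , repeated = to (sDupBag-∷ 1≤x) bag in
                                bag′ , to drop-x (half∤x ∘ repeated , small) })
      (λ (bag′ , small) → let x∉q , small′ = from drop-x small in
                          from (sDupBag-∷ 1≤x) (bag′ , ⊥-elim ∘ x∉q) , inj₁ (here refl) ∷ small′)
    with-x : length (filter (x ∈?_) ps) ≡ length (partitionsIn xs (n - + x) (k - + 1))
    with-x = length-filter-∈ (λ p↭q (bag , small) → sDupBag-↭ p↭q bag , All-resp-↭ p↭q small) remove-x
               (partitionsIn-enumerates (x ∷ xs) n k) (partitionsIn-enumerates xs _ _)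
    without-x : length (filter (∁? (x ∈?_)) ps) ≡ length (partitionsIn xs n k)
    without-x = length-≐
      ((λ ((p↗ , bag , small) , x∉p) → p↗ , bag , to drop-x (x∉p , small)) ,
       (λ (p↗ , bag , small) → let x∉p , small′ = from drop-x small in (p↗ , bag , small′) , x∉p))
      (filter-enumerates (∁? (x ∈?_)) (partitionsIn-enumerates (x ∷ xs) n k)) (partitionsIn-enumerates xs n k)

  length-partitionsIn-[] : ∀ n k → length (partitionsIn [] n k) ≡ length (partitionsℤ (n - + half * k) k)
  length-partitionsIn-[] n k =
    sym (length-≡-bijection (from (shift⇔ _)) (λ _ _ → map-injective (+-cancelˡ-≡ half _ _)) onto
           (partitionsℤ-enumerates _ k) (partitionsIn-enumerates [] n k))
    where
    above : ∀ {p} → SmallPartsIn [] p → All (half <_) p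
    above = All.map [ (λ ()) , id ]′
    shift⇔ : ∀ q → (Sorted ∩ (SDupBag n k ∩ SmallPartsIn [])) (map (half ℕ.+_) q) ⇔
                   (Sorted ∩ SDupBag (n - + half * k) k) q
    shift⇔ q = mk⇔
      (λ (p↗ , (bag , rep) , small) →
         Linked.map (+-cancelˡ-≤ half _ _) (Linked-map⁻ p↗) ,
         to (partitionBag-map half q) (bag , above small) , to (repeatsDivisibleBy-map q) rep)
      (λ (q↗ , bag , rep) → let bag′ , above′ = from (partitionBag-map half q) bag in
         Linked-map⁺ (Linked.map (+-monoʳ-≤ half) q↗) ,
         (bag′ , from (repeatsDivisibleBy-map q) rep) , All.map inj₂ above′)
    unshift : ∀ {p} → All (half <_) p → map (half ℕ.+_) (map (_∸ half) p) ≡ p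
    unshift []               = refl
    unshift (half<y ∷ above) = cong₂ _∷_ (m+[n∸m]≡n (<⇒≤ half<y)) (unshift above)
    onto : ∀ {p} → (Sorted ∩ (SDupBag n k ∩ SmallPartsIn [])) p →
           ∃[ q ] (Sorted ∩ SDupBag (n - + half * k) k) q × map (half ℕ.+_) q ≡ p
    onto {p} P@(_ , _ , small) = let p≡ = unshift (above small) in
      map (_∸ half) p , to (shift⇔ _) (subst (Sorted ∩ (SDupBag n k ∩ SmallPartsIn [])) (sym p≡) P) , p≡

  summand : ℤ → ℤ → List ℕ → ℕ
  summand n k α = Dℤ s (n - + half * (k - + length α) - + sum α) (k - + length α)

  summand-[] : ∀ n k → summand n k [] ≡ Dℤ s (n - + half * k) k
  summand-[] n k = cong₂ (Dℤ s) (n-h[k-0]-0≡n-hk n (+ half) k) (k-0≡k k)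
    where
    n-h[k-0]-0≡n-hk : ∀ n h k → n - h * (k - + 0) - + 0 ≡ n - h * k
    n-h[k-0]-0≡n-hk = solve-∀
    k-0≡k : ∀ k → k - + 0 ≡ k
    k-0≡k = solve-∀

  summand-∷ : ∀ n k x α → summand n k (x ∷ α) ≡ summand (n - + x) (k - + 1) α
  summand-∷ n k x α =
    cong₂ (Dℤ s) (regroup n (+ half) k (+ length α) (+ x) (+ sum α)) (k-[1+l]≡k-1-l k (+ length α))
    where
    regroup : ∀ n h k l x a → n - h * (k - (+ 1 ℤ.+ l)) - (x ℤ.+ a) ≡ n - x - h * (k - + 1 - l) - a
    regroup = solve-∀
    k-[1+l]≡k-1-l : ∀ k l → k - (+ 1 ℤ.+ l) ≡ k - + 1 - l
    k-[1+l]≡k-1-l = solve-∀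

  length-partitionsIn-sublists : ∀ {xs} → Unique xs → All (λ x → 1 ≤ x × x < half) xs → ∀ n k →
    length (partitionsIn xs n k) ≡ sum (map (summand n k) (sublists xs))
  length-partitionsIn-sublists [] [] n k = begin
      length (partitionsIn [] n k)
    ≡⟨ length-partitionsIn-[] n k ⟩
      length (partitionsℤ (n - + half * k) k)
    ≡⟨ length-partitionsℤ (n - + half * k) k ⟩
      Dℤ s (n - + half * k) k
    ≡⟨ sym (trans (+-identityʳ _) (summand-[] n k)) ⟩
      sum (map (summand n k) (sublists []))
    ∎
    where open ≡-Reasoning
  length-partitionsIn-sublists {x ∷ xs} (x∉ ∷ unique) ((1≤x , x<half) ∷ bounded) n k = begin
      length (partitionsIn (x ∷ xs) n k)
    ≡⟨ length-partitionsIn-∷ 1≤x x<half (All¬⇒¬Any x∉) n k ⟩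
      length (partitionsIn xs n k) + length (partitionsIn xs (n - + x) (k - + 1))
    ≡⟨ cong₂ _+_ (length-partitionsIn-sublists unique bounded n k)
                 (length-partitionsIn-sublists unique bounded (n - + x) (k - + 1)) ⟩
      sum (map (summand n k) (sublists xs)) + sum (map (summand (n - + x) (k - + 1)) (sublists xs))
    ≡⟨ cong (λ m → sum (map (summand n k) (sublists xs)) + sum m)
            (trans (map-cong (λ α → sym (summand-∷ n k x α)) (sublists xs)) (map-∘ (sublists xs))) ⟩
      sum (map (summand n k) (sublists xs)) + sum (map (summand n k) (map (x ∷_) (sublists xs)))
    ≡⟨ sym (trans (cong sum (map-++ (summand n k) (sublists xs) _))
                  (sum-++ (map (summand n k) (sublists xs)) (map (summand n k) (map (x ∷_) (sublists xs))))) ⟩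
      sum (map (summand n k) (sublists (x ∷ xs)))
    ∎
    where open ≡-Reasoning

  smallParts-unique : Unique smallParts
  smallParts-unique = Unique.map⁺ suc-injective (Unique.upTo⁺ _)

  smallParts-bounded : All (λ x → 1 ≤ x × x < half) smallParts
  smallParts-bounded = All.tabulate (to (∈-map-suc-upTo-pred half))

-- The proof only uses 1 ≤ s / 2.
theorem8 : (s : ℕ) → 4 ≤ s → 2 ∣ s → (n k : ℕ) → 1 ≤ n → 1 ≤ k →
    D s n k ≡ Dℤ s (+ n - + (s / 2)) (+ k - + 1)
      Data.Nat.+ sum (map (λ α → Dℤ s (+ n - (+ (s / 2)) * (+ k - + length α) - + sum α)
                                      (+ k - + length α)) (𝔸 s))
theorem8 s 4≤s _ n k _ _ = begin
    D s n k
  ≡⟨ length-partitionsℤ-split 1≤half (+ n) (+ k) ⟩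
    length (partitionsℤ (+ n - + half) (+ k - + 1)) + length (partitionsIn smallParts (+ n) (+ k))
  ≡⟨ cong₂ _+_ (length-partitionsℤ (+ n - + half) (+ k - + 1))
               (length-partitionsIn-sublists smallParts-unique smallParts-bounded (+ n) (+ k)) ⟩
    Dℤ s (+ n - + half) (+ k - + 1) + sum (map (summand (+ n) (+ k)) (𝔸 s))
  ∎
  where
  open Counting s
  open ≡-Reasoning
  1≤half : 1 ≤ half
  1≤half = /-monoˡ-≤ 2 (≤-trans (s≤s (s≤s z≤n)) 4≤s)
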